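{- Let $X$ be a finite abstract simplicial complex on a vertex set $A$, and let $x,y$ be two new elements not in $A$. Define the suspension $\Sigma X$ as the collection of subsets of $A\cup\{x,y\}$ consisting of all sets in $X$, the sets $a\cup\{x\}$ and $a\cup\{y\}$ for each $a\in X$, and the sets $\{x\}$ and $\{y\}$. Then $X$ and $\Sigma X$ have the same win/loss value in the simplicial take-away game: $X$ is a first player win if and only if $\Sigma X$ is a first player win.
   Context: A finite abstract simplicial complex is a finite collection $X$ of non-empty finite sets such that every non-empty subset of a member of $X$ is again in $X$. The simplicial take-away game on a position $X$: two players alternate; a move consists of choosing a set $s\in X$ and replacing the position by $\{a\in X: s\not\subseteq a\}$ (i.e. erasing $s$ together with every set containing it). A player who cannot move (the position is empty) loses. Since the game is finite, every position is either a first player win (the player to move has a winning strategy) or a second player win. -}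

module Defs where

open import Data.Nat using (ℕ; suc)
open import Data.Fin using (Fin)
open import Data.Fin.Subset using (Subset; _⊆_; Nonempty; inside; outside)
open import Data.Fin.Subset.Properties using (_⊆?_)
open import Data.Vec using (_∷_)
open import Data.List using (List; []; _∷_; filter; map; _++_)
open import Data.List.Membership.Propositional using (_∈_)
open import Data.Product using (Σ; _×_)
open import Relation.Nullary using (¬?)

-- A finite position / abstract simplicial complex on the vertex set Fin n:
-- a finite collection (list; repetitions are harmless) of faces, each face
-- a subset of Fin n.
Complex : ℕ → Set
Complex n = List (Subset n)

IsSimplicialComplex : ∀ {n} → Complex n → Set
IsSimplicialComplex {n} X =
  (∀ {a} → a ∈ X → Nonempty a) ×
  (∀ {a} (b : Subset n) → a ∈ X → Nonempty b → b ⊆ a → b ∈ X)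

-- The move "choose s": erase s together with every set containing it,
-- i.e. keep exactly the a with s ⊈ a.
erase : ∀ {n} → Subset n → Complex n → Complex n
erase s X = filter (λ a → ¬? (s ⊆? a)) X

-- SecondWin X : every move leads to a position that is a first player win
-- (in particular the empty position is a second player win).
data FirstWin {n : ℕ} (X : Complex n) : Set
data SecondWin {n : ℕ} (X : Complex n) : Set

data FirstWin {n} X where
  move : (s : Subset n) → s ∈ X → SecondWin (erase s X) → FirstWin X

data SecondWin {n} X where
  allMoves : (∀ {s} → s ∈ X → FirstWin (erase s X)) → SecondWin X

-- Suspension.  The new vertices are x = index 0 and y = index 1 of
-- Fin (2 + n); the old vertex set Fin n is embedded as indices 2..n+1.
embed : ∀ {n} → Subset n → Subset (suc (suc n))
embed a = outside ∷ outside ∷ a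

withX : ∀ {n} → Subset n → Subset (suc (suc n))
withX a = inside ∷ outside ∷ a

withY : ∀ {n} → Subset n → Subset (suc (suc n))
withY a = outside ∷ inside ∷ a

open import Data.Fin.Subset using (⊥)

suspension : ∀ {n} → Complex n → Complex (suc (suc n))
suspension {n} X =
  map embed X ++ map withX X ++ map withY X ++ (withX ⊥ ∷ withY ⊥ ∷ [])

{-# OPTIONS --safe #-}
-- ΣX consists of X on the old vertices together with the two cones x * L and y * L
-- over L = X ∪ {∅}.  More generally, a position made of a base Y and two cones over one
-- family Z has the value of Y.  A winning move in Y stays winning, since it erases the
-- same faces from both cones and keeps the shape.  Conversely, a move in one cone is
-- answered by the mirror move in the other, which restores the shape with Z shrunk, so
-- induction on the game tree of Y and on the size of Z carries both directions.
module Submission where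

open import Defs
open import Data.Nat using (ℕ; suc; _<_)
open import Data.Nat.Induction using (<-wellFounded)
open import Induction.WellFounded using (Acc; acc)
open import Data.Product using (_×_; _,_; proj₁; proj₂; map₁; uncurry)
open import Data.Vec using (_∷_; here)
open import Data.Fin.Subset using (Subset; _⊆_; inside; outside; ⊥)
open import Data.Fin.Subset.Properties using (_⊆?_; drop-∷-⊆; out⊆; in⊆in)
open import Data.List using ([]; _∷_; map; length)
open import Data.List.Membership.Propositional using (_∈_)
open import Data.List.Membership.Propositional.Properties
  using (∈-filter⁺; ∈-filter⁻; ∈-map⁺; ∈-++⁺ˡ; ∈-++⁺ʳ)
open import Data.List.Properties using (filter-notAll)
open import Data.List.Relation.Unary.Any using (here; there)
import Data.List.Relation.Unary.Any as Any
open import Data.List.Relation.Unary.All using (All; []; _∷_; tabulate; lookup)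
open import Data.List.Relation.Unary.All.Properties using (map⁺; ++⁺)
import Data.Empty as Empty
open import Function using (_∘_; id)
open import Level using (0ℓ)
open import Relation.Nullary using (¬_; ¬?)
open import Relation.Unary using (Pred; _≐_; _∩_; ∁)
open import Relation.Unary.Properties using (≐-trans)
open import Relation.Binary.PropositionalEquality using (refl)

private variable
  n : ℕ
  a s : Subset n
  X Y Z W : Complex n
  P : Pred (Subset n) 0ℓ

∈-erase⁻ : a ∈ erase s X → a ∈ X × ¬ s ⊆ a
∈-erase⁻ {s = s} = ∈-filter⁻ (λ b → ¬? (s ⊆? b))

∈-erase⁺ : a ∈ X → ¬ s ⊆ a → a ∈ erase s X
∈-erase⁺ {s = s} = ∈-filter⁺ (λ b → ¬? (s ⊆? b))

erase-≐ : (_∈ X) ≐ P → (_∈ erase s X) ≐ (P ∩ ∁ (s ⊆_))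
erase-≐ (sound , complete) = map₁ sound ∘ ∈-erase⁻ , uncurry (∈-erase⁺ ∘ complete)

length-erase-< : s ∈ X → length (erase s X) < length X
length-erase-< {s = s} {X = X} s∈X =
  filter-notAll (λ b → ¬? (s ⊆? b)) X (Any.map (λ { refl s⊈s → s⊈s id }) s∈X)

in⊈out : ¬ inside ∷ s ⊆ outside ∷ a
in⊈out s⊆a with s⊆a here
... | ()

-- Y together with the cones x * Z and y * W; the cone face over ⊥ is the bare apex.
Bicone : Complex n → Complex n → Complex n → Pred (Subset (suc (suc n))) 0ℓ
Bicone Y Z W (outside ∷ outside ∷ a) = a ∈ Y
Bicone Y Z W (inside  ∷ outside ∷ a) = a ∈ Z
Bicone Y Z W (outside ∷ inside  ∷ a) = a ∈ W
Bicone Y Z W (inside  ∷ inside  ∷ a) = Empty.⊥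

erase-embed : (_∈ X) ≐ Bicone Y Z W →
              (_∈ erase (embed s) X) ≐ Bicone (erase s Y) (erase s Z) (erase s W)
erase-embed {Y = Y} {Z = Z} {W = W} {s = s} X≐ = ≐-trans (erase-≐ X≐) (to , from)
  where
  to : ∀ {t} → Bicone Y Z W t × ¬ embed s ⊆ t → Bicone (erase s Y) (erase s Z) (erase s W) t
  to {outside ∷ outside ∷ a} (a∈Y , s⊈a) = ∈-erase⁺ a∈Y (s⊈a ∘ out⊆ ∘ out⊆)
  to {inside  ∷ outside ∷ a} (a∈Z , s⊈a) = ∈-erase⁺ a∈Z (s⊈a ∘ out⊆ ∘ out⊆)
  to {outside ∷ inside  ∷ a} (a∈W , s⊈a) = ∈-erase⁺ a∈W (s⊈a ∘ out⊆ ∘ out⊆)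
  from : ∀ {t} → Bicone (erase s Y) (erase s Z) (erase s W) t → Bicone Y Z W t × ¬ embed s ⊆ t
  from {outside ∷ outside ∷ a} m = let a∈Y , s⊈a = ∈-erase⁻ m in a∈Y , s⊈a ∘ drop-∷-⊆ ∘ drop-∷-⊆
  from {inside  ∷ outside ∷ a} m = let a∈Z , s⊈a = ∈-erase⁻ m in a∈Z , s⊈a ∘ drop-∷-⊆ ∘ drop-∷-⊆
  from {outside ∷ inside  ∷ a} m = let a∈W , s⊈a = ∈-erase⁻ m in a∈W , s⊈a ∘ drop-∷-⊆ ∘ drop-∷-⊆

erase-withX : (_∈ X) ≐ Bicone Y Z W → (_∈ erase (withX s) X) ≐ Bicone Y (erase s Z) W
erase-withX {Y = Y} {Z = Z} {W = W} {s = s} X≐ = ≐-trans (erase-≐ X≐) (to , from)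
  where
  to : ∀ {t} → Bicone Y Z W t × ¬ withX s ⊆ t → Bicone Y (erase s Z) W t
  to {outside ∷ outside ∷ a} (a∈Y , _)   = a∈Y
  to {inside  ∷ outside ∷ a} (a∈Z , s⊈a) = ∈-erase⁺ a∈Z (s⊈a ∘ in⊆in ∘ out⊆)
  to {outside ∷ inside  ∷ a} (a∈W , _)   = a∈W
  from : ∀ {t} → Bicone Y (erase s Z) W t → Bicone Y Z W t × ¬ withX s ⊆ t
  from {outside ∷ outside ∷ a} a∈Y = a∈Y , in⊈out
  from {inside  ∷ outside ∷ a} m   = let a∈Z , s⊈a = ∈-erase⁻ m in a∈Z , s⊈a ∘ drop-∷-⊆ ∘ drop-∷-⊆
  from {outside ∷ inside  ∷ a} a∈W = a∈W , in⊈out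

erase-withY : (_∈ X) ≐ Bicone Y Z W → (_∈ erase (withY s) X) ≐ Bicone Y Z (erase s W)
erase-withY {Y = Y} {Z = Z} {W = W} {s = s} X≐ = ≐-trans (erase-≐ X≐) (to , from)
  where
  to : ∀ {t} → Bicone Y Z W t × ¬ withY s ⊆ t → Bicone Y Z (erase s W) t
  to {outside ∷ outside ∷ a} (a∈Y , _)   = a∈Y
  to {inside  ∷ outside ∷ a} (a∈Z , _)   = a∈Z
  to {outside ∷ inside  ∷ a} (a∈W , s⊈a) = ∈-erase⁺ a∈W (s⊈a ∘ out⊆ ∘ in⊆in)
  from : ∀ {t} → Bicone Y Z (erase s W) t → Bicone Y Z W t × ¬ withY s ⊆ t
  from {outside ∷ outside ∷ a} a∈Y = a∈Y , in⊈out ∘ drop-∷-⊆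
  from {inside  ∷ outside ∷ a} a∈Z = a∈Z , in⊈out ∘ drop-∷-⊆
  from {outside ∷ inside  ∷ a} m   = let a∈W , s⊈a = ∈-erase⁻ m in a∈W , s⊈a ∘ drop-∷-⊆ ∘ drop-∷-⊆

withY∈erase-withX : (_∈ X) ≐ Bicone Y Z W → a ∈ W → withY a ∈ erase (withX a) X
withY∈erase-withX (_ , complete) a∈W = ∈-erase⁺ (complete a∈W) in⊈out

withX∈erase-withY : (_∈ X) ≐ Bicone Y Z W → a ∈ Z → withX a ∈ erase (withY a) X
withX∈erase-withY (_ , complete) a∈Z = ∈-erase⁺ (complete a∈Z) (in⊈out ∘ drop-∷-⊆)

firstWin-bicone⁺ : FirstWin Y → (_∈ X) ≐ Bicone Y Z Z → FirstWin X
secondWin-bicone⁺ : SecondWin Y → Acc _<_ (length Z) → (_∈ X) ≐ Bicone Y Z Z → SecondWin X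
firstWin-erase-bicone : SecondWin Y → Acc _<_ (length Z) → (_∈ X) ≐ Bicone Y Z Z →
                        ∀ {t} → Bicone Y Z Z t → FirstWin (erase t X)

firstWin-bicone⁺ (move s s∈Y Y∖s-lost) X≐ =
  move (embed s) (proj₂ X≐ s∈Y) (secondWin-bicone⁺ Y∖s-lost (<-wellFounded _) (erase-embed X≐))

secondWin-bicone⁺ Y-lost Z-acc X≐ = allMoves (firstWin-erase-bicone Y-lost Z-acc X≐ ∘ proj₁ X≐)

firstWin-erase-bicone (allMoves Y∖s-won) _ X≐ {outside ∷ outside ∷ a} a∈Y =
  firstWin-bicone⁺ (Y∖s-won a∈Y) (erase-embed X≐)
firstWin-erase-bicone Y-lost (acc shorter) X≐ {inside ∷ outside ∷ a} a∈Z =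
  move (withY a) (withY∈erase-withX X≐ a∈Z)
    (secondWin-bicone⁺ Y-lost (shorter (length-erase-< a∈Z)) (erase-withY (erase-withX X≐)))
firstWin-erase-bicone Y-lost (acc shorter) X≐ {outside ∷ inside ∷ a} a∈Z =
  move (withX a) (withX∈erase-withY X≐ a∈Z)
    (secondWin-bicone⁺ Y-lost (shorter (length-erase-< a∈Z)) (erase-withX (erase-withY X≐)))

firstWin-bicone⁻ : FirstWin X → (_∈ X) ≐ Bicone Y Z Z → FirstWin Y
secondWin-bicone⁻ : SecondWin X → (_∈ X) ≐ Bicone Y Z Z → SecondWin Y

firstWin-bicone⁻ {X = X} {Y = Y} {Z = Z} (move t t∈X X∖t-lost) X≐ = answer (proj₁ X≐ t∈X) X∖t-lost
  where
  answer : ∀ {t} → Bicone Y Z Z t → SecondWin (erase t X) → FirstWin Y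
  answer {outside ∷ outside ∷ a} a∈Y X∖a-lost = move a a∈Y (secondWin-bicone⁻ X∖a-lost (erase-embed X≐))
  answer {inside  ∷ outside ∷ a} a∈Z (allMoves won) =
    firstWin-bicone⁻ (won (withY∈erase-withX X≐ a∈Z)) (erase-withY (erase-withX X≐))
  answer {outside ∷ inside  ∷ a} a∈Z (allMoves won) =
    firstWin-bicone⁻ (won (withX∈erase-withY X≐ a∈Z)) (erase-withX (erase-withY X≐))

secondWin-bicone⁻ (allMoves X∖s-won) X≐ =
  allMoves λ s∈Y → firstWin-bicone⁻ (X∖s-won (proj₂ X≐ s∈Y)) (erase-embed X≐)

∈-suspension : (_∈ suspension X) ≐ Bicone X (⊥ ∷ X) (⊥ ∷ X)
∈-suspension {X = X} = lookup faces , from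
  where
  faces : All (Bicone X (⊥ ∷ X) (⊥ ∷ X)) (suspension X)
  faces = ++⁺ (map⁺ {f = embed} (tabulate id))
         (++⁺ (map⁺ {f = withX} (tabulate there))
         (++⁺ (map⁺ {f = withY} (tabulate there))
              (here refl ∷ here refl ∷ [])))
  from : ∀ {t} → Bicone X (⊥ ∷ X) (⊥ ∷ X) t → t ∈ suspension X
  from {outside ∷ outside ∷ a} a∈X = ∈-++⁺ˡ (∈-map⁺ embed a∈X)
  from {inside  ∷ outside ∷ a} (there a∈X) = ∈-++⁺ʳ (map embed X) (∈-++⁺ˡ (∈-map⁺ withX a∈X))
  from {outside ∷ inside  ∷ a} (there a∈X) =
    ∈-++⁺ʳ (map embed X) (∈-++⁺ʳ (map withX X) (∈-++⁺ˡ (∈-map⁺ withY a∈X)))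
  from {inside  ∷ outside ∷ a} (here refl) =
    ∈-++⁺ʳ (map embed X) (∈-++⁺ʳ (map withX X) (∈-++⁺ʳ (map withY X) (here refl)))
  from {outside ∷ inside  ∷ a} (here refl) =
    ∈-++⁺ʳ (map embed X) (∈-++⁺ʳ (map withX X) (∈-++⁺ʳ (map withY X) (there (here refl))))

mainTheorem2 : (n : ℕ) (X : Complex n) → IsSimplicialComplex X →
    (FirstWin X → FirstWin (suspension X)) × (FirstWin (suspension X) → FirstWin X)
mainTheorem2 n X _ =
  (λ X-won → firstWin-bicone⁺ X-won ∈-suspension) ,
  (λ ΣX-won → firstWin-bicone⁻ ΣX-won ∈-suspension)
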